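{- Let $a>0$. Let $(x_k)_{k\ge 0}$ be the sequence of integers with $x_0\ge 1$ and $$x_{k+1} := \begin{cases} x_k-\lceil a\cdot x_k^{2/3}\rceil & \text{if } x_k\ge 1,\\ 0 & \text{if } x_k<1.\end{cases}$$ Then for every integer $k\ge \frac{3\sqrt[3]{x_0}}{a}$ we have $x_k\le 1$. -}

module Defs where

open import Level using (0ℓ)
open import Data.Product using (Σ; ∃; _×_)
open import Data.Integer as ℤ using (ℤ)
open import Data.Rational as ℚ using (ℚ; _/_; 0ℚ; _≤_; _<_)
open import Relation.Nullary using (¬_)
open import Relation.Binary.PropositionalEquality using (_≡_)

⟦_⟧ : ℤ → ℚ
⟦ z ⟧ = z / 1

cube : ℚ → ℚ
cube q = q ℚ.* q ℚ.* q

-- A positive real number, given as a Dedekind cut: the set of rationals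
-- strictly below it.
record PosReal : Set₁ where
  field
    Lower      : ℚ → Set
    bounded    : ∃ λ q → ¬ Lower q
    downClosed : ∀ {p q} → p < q → Lower q → Lower p
    rounded    : ∀ {q} → Lower q → ∃ λ r → q < r × Lower r
    positive   : Lower 0ℚ

open PosReal public

-- a · x^(2/3) ≤ m   (for an integer x ≥ 0):
-- every rational 0 ≤ q < a satisfies q · x^(2/3) ≤ m, i.e. q³ x² ≤ m³.
MulPow23≤ : PosReal → ℤ → ℤ → Set
MulPow23≤ a x m =
  ∀ q → Lower a q → 0ℚ ≤ q → cube q ℚ.* ⟦ x ℤ.* x ⟧ ≤ cube ⟦ m ⟧

-- m < a · x^(2/3):
-- some rational 0 ≤ q < a satisfies m < q · x^(2/3), i.e. m³ < q³ x².
<MulPow23 : PosReal → ℤ → ℤ → Set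
<MulPow23 a x m =
  ∃ λ q → Lower a q × 0ℚ ≤ q × cube ⟦ m ⟧ < cube q ℚ.* ⟦ x ℤ.* x ⟧

IsCeilMulPow23 : PosReal → ℤ → ℤ → Set
IsCeilMulPow23 a x c = MulPow23≤ a x c × <MulPow23 a x (c ℤ.- ℤ.1ℤ)

Step : PosReal → ℤ → ℤ → Set
Step a x x' =
  (ℤ.1ℤ ℤ.≤ x → Σ ℤ λ c → IsCeilMulPow23 a x c × x' ≡ x ℤ.- c)
  × (x ℤ.< ℤ.1ℤ → x' ≡ ℤ.0ℤ)

-- The real number 3 · x0^(1/3) / a is ≤ k (k a natural number),
-- i.e. 3 x0^(1/3) / k ≤ a (false for k = 0), i.e. every rational
-- 0 ≤ r < 3 x0^(1/3) / k (equivalently r³ k³ < 27 x0) lies below a.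
Threshold≤ : PosReal → ℤ → ℤ → Set
Threshold≤ a x0 k =
  ∀ r → 0ℚ ≤ r → cube r ℚ.* cube ⟦ k ⟧ < ⟦ ℤ.+ 27 ℤ.* x0 ⟧ → Lower a r

{-# OPTIONS --safe #-}
module Submission where

-- Put yⱼ = ∛xⱼ. While xⱼ₊₁ ≥ 1, concavity of the cube root gives
-- yⱼ − yⱼ₊₁ ≥ (xⱼ − xⱼ₊₁) / (3 xⱼ^(2/3)) ≥ a/3, so xₖ ≥ 1 would force
-- y₀ ≥ 1 + k a/3 > y₀ once k ≥ 3 y₀ / a; in fact xₖ < 1.
-- Constructively, a is replaced by the rational r = 3n/(2k) < a, where
-- n³ < 8 x₀ ≤ (n+1)³, and yⱼ by the rational lower bounds U/(2k) ≤ yⱼ.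
-- Going back one step adds n/(2k) to the bound, so starting from U = 2k
-- at index k we reach (1 + n/2)³ ≤ x₀ ≤ ((n+1)/2)³, which is absurd.
-- The one-step estimate is proved in ℕ by cross-multiplying, using that
-- t ↦ t³/(K+t)² is increasing.

open import Defs

module CubeRootDescent where

  open import Data.Empty using (⊥; ⊥-elim)
  open import Data.Integer as ℤ using (ℤ; +_; -[1+_]; 0ℤ; 1ℤ)
  import Data.Integer.Properties as ℤP
  open import Data.Nat
  open import Data.Nat.Properties
  open import Data.Nat.Tactic.RingSolver using (solve-∀)
  open import Data.Product using (∃-syntax; _×_; _,_)
  open import Data.Rational as ℚ using (ℚ; 0ℚ; toℚᵘ)
  import Data.Rational.Properties as ℚP
  open import Data.Rational.Unnormalised as ℚᵘ using (mkℚᵘ; *≤*; *<*)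
  import Data.Rational.Unnormalised.Properties as ℚᵘP
  open import Data.Sum using (inj₁; inj₂)
  open import Relation.Binary.PropositionalEquality
  open import Relation.Nullary using (¬_; yes; no)

  infix 8 _² _³

  _² : ℕ → ℕ
  n ² = n * n

  _³ : ℕ → ℕ
  n ³ = n * n * n

  ²-mono-≤ : ∀ {m n} → m ≤ n → m ² ≤ n ²
  ²-mono-≤ m≤n = *-mono-≤ m≤n m≤n

  ³-mono-≤ : ∀ {m n} → m ≤ n → m ³ ≤ n ³
  ³-mono-≤ m≤n = *-mono-≤ (*-mono-≤ m≤n m≤n) m≤n

  ³-mono-< : ∀ {m n} → m < n → m ³ < n ³
  ³-mono-< m<n = *-mono-< (*-mono-< m<n m<n) m<n

  ∃-cube-bracket : ∀ B → 0 < B → ∃[ n ] n ³ < B × B ≤ suc n ³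
  ∃-cube-bracket (suc zero) _ = 0 , z<s , s≤s z≤n
  ∃-cube-bracket (suc (suc B)) _ with ∃-cube-bracket (suc B) z<s
  ... | n , n³<1+B , 1+B≤[1+n]³ with m≤n⇒m<n∨m≡n 1+B≤[1+n]³
  ...   | inj₁ 1+B<[1+n]³ = n , m<n⇒m<1+n n³<1+B , 1+B<[1+n]³
  ...   | inj₂ 1+B≡[1+n]³ =
    suc n ,
    subst (_< suc (suc B)) 1+B≡[1+n]³ (n<1+n (suc B)) ,
    subst (λ c → suc c ≤ suc (suc n) ³) (sym 1+B≡[1+n]³) (³-mono-< (n<1+n (suc n)))

  cube/square-strictMono : ∀ {K s t} → 0 < K → s < t →
                           s ³ * (K + t) ² < t ³ * (K + s) ²
  cube/square-strictMono {K} {s} {t} K>0 s<t = begin-strict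
    s ³ * (K + t) ²      ≡⟨ regroup s (K + t) ⟩
    s * (s * (K + t)) ²  ≤⟨ *-monoʳ-≤ s (²-mono-≤ cross) ⟩
    s * (t * (K + s)) ²  <⟨ *-monoˡ-< ((t * (K + s)) ²) {{>-nonZero (*-mono-< P>0 P>0)}} s<t ⟩
    t * (t * (K + s)) ²  ≡⟨ regroup t (K + s) ⟨
    t ³ * (K + s) ²      ∎
    where
    open ≤-Reasoning
    regroup : ∀ u v → u * u * u * (v * v) ≡ u * ((u * v) * (u * v))
    regroup = solve-∀
    P>0 : 0 < t * (K + s)
    P>0 = *-mono-< (<-≤-trans z<s s<t) (<-≤-trans K>0 (m≤m+n K s))
    cross : s * (K + t) ≤ t * (K + s)
    cross = begin
      s * (K + t)    ≡⟨ *-distribˡ-+ s K t ⟩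
      s * K + s * t  ≤⟨ +-mono-≤ (*-monoˡ-≤ K (<⇒≤ s<t)) (≤-reflexive (*-comm s t)) ⟩
      t * K + t * s  ≡⟨ *-distribˡ-+ t K s ⟨
      t * (K + s)    ∎

  cube/square-cancel-≤ : ∀ {K s t γ} → 0 < K →
                         γ * (K + s) ² ≤ s ³ → t ³ ≤ γ * (K + t) ² → t ≤ s
  cube/square-cancel-≤ {K} {s} {t} {γ} K>0 γ[K+s]²≤s³ t³≤γ[K+t]² =
    ≮⇒≥ λ s<t → <-irrefl refl (begin-strict
    s ³ * (K + t) ²            <⟨ cube/square-strictMono K>0 s<t ⟩
    t ³ * (K + s) ²            ≤⟨ *-monoˡ-≤ ((K + s) ²) t³≤γ[K+t]² ⟩
    γ * (K + t) ² * (K + s) ²  ≡⟨ swap γ ((K + t) ²) ((K + s) ²) ⟩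
    γ * (K + s) ² * (K + t) ²  ≤⟨ *-monoˡ-≤ ((K + t) ²) γ[K+s]²≤s³ ⟩
    s ³ * (K + t) ²            ∎)
    where
    open ≤-Reasoning
    swap : ∀ a b c → a * b * c ≡ a * c * b
    swap = solve-∀

  [m+n]³∸m³≤3n[m+n]² : ∀ m n → (m + n) ³ ∸ m ³ ≤ 3 * n * (m + n) ²
  [m+n]³∸m³≤3n[m+n]² m n = begin
    (m + n) ³ ∸ m ³                   ≡⟨ cong (_∸ m ³) (expand m n) ⟩
    m ³ + T ∸ m ³                     ≡⟨ m+n∸m≡n (m ³) T ⟩
    T                                 ≤⟨ m≤m+n T (3 * m * n * n + 2 * n ³) ⟩
    T + (3 * m * n * n + 2 * n ³)     ≡⟨ complete m n ⟩
    3 * n * (m + n) ²                 ∎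
    where
    open ≤-Reasoning
    T = 3 * m * m * n + 3 * m * n * n + n ³
    expand : ∀ m n → (m + n) * (m + n) * (m + n)
                   ≡ m * m * m + (3 * m * m * n + 3 * m * n * n + n * n * n)
    expand = solve-∀
    complete : ∀ m n → 3 * m * m * n + 3 * m * n * n + n * n * n
                         + (3 * m * n * n + 2 * (n * n * n))
                     ≡ 3 * n * ((m + n) * (m + n))
    complete = solve-∀

  -- U/D ≤ ∛m and C ≥ (3n/D)·(m+C)^(2/3) give (U+n)/D ≤ ∛(m+C): the secant
  -- estimate ∛X − ∛(X−C) ≥ C/(3 X^(2/3)) for X = m + C.
  cubeRoot-increment : ∀ {D n U m C} → 0 < U → U ³ ≤ D ³ * m →
                       (3 * n) ³ * (m + C) ² ≤ D ³ * C ³ →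
                       (U + n) ³ ≤ D ³ * (m + C)
  cubeRoot-increment {D} {n} {U} {m} {C} U>0 U³≤D³m bound = begin
    (U + n) ³            ≡⟨ m+[n∸m]≡n U³≤[U+n]³ ⟨
    K + ((U + n) ³ ∸ K)  ≤⟨ +-monoʳ-≤ K t≤s ⟩
    K + (Y ∸ K)          ≡⟨ m+[n∸m]≡n K≤Y ⟩
    Y                    ∎
    where
    open ≤-Reasoning
    K = U ³
    Y = D ³ * (m + C)
    U³≤[U+n]³ : K ≤ (U + n) ³
    U³≤[U+n]³ = ³-mono-≤ (m≤m+n U n)
    K≤Y : K ≤ Y
    K≤Y = ≤-trans U³≤D³m (*-monoʳ-≤ (D ³) (m≤m+n m C))
    D³C≤Y∸K : D ³ * C ≤ Y ∸ K
    D³C≤Y∸K = begin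
      D ³ * C                    ≤⟨ m≤n+m (D ³ * C) (D ³ * m ∸ K) ⟩
      D ³ * m ∸ K + D ³ * C      ≡⟨ +-∸-comm (D ³ * C) U³≤D³m ⟨
      D ³ * m + D ³ * C ∸ K      ≡⟨ cong (_∸ K) (*-distribˡ-+ (D ³) m C) ⟨
      Y ∸ K                      ∎
    regroupY : ∀ a d x → a * a * a * ((d * d * d * x) * (d * d * d * x))
                       ≡ d * d * d * (d * d * d) * (a * a * a * (x * x))
    regroupY = solve-∀
    regroupC : ∀ d c → d * d * d * (d * d * d) * (d * d * d * (c * c * c))
                     ≡ (d * d * d * c) * (d * d * d * c) * (d * d * d * c)
    regroupC = solve-∀
    regroupU : ∀ a v → (a * (v * v)) * (a * (v * v)) * (a * (v * v))
                     ≡ a * a * a * ((v * v * v) * (v * v * v))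
    regroupU = solve-∀
    s-bound : (3 * n) ³ * (K + (Y ∸ K)) ² ≤ (Y ∸ K) ³
    s-bound = begin
      (3 * n) ³ * (K + (Y ∸ K)) ²           ≡⟨ cong (λ z → (3 * n) ³ * z ²) (m+[n∸m]≡n K≤Y) ⟩
      (3 * n) ³ * Y ²                       ≡⟨ regroupY (3 * n) D (m + C) ⟩
      D ³ * D ³ * ((3 * n) ³ * (m + C) ²)   ≤⟨ *-monoʳ-≤ (D ³ * D ³) bound ⟩
      D ³ * D ³ * (D ³ * C ³)               ≡⟨ regroupC D C ⟩
      (D ³ * C) ³                           ≤⟨ ³-mono-≤ D³C≤Y∸K ⟩
      (Y ∸ K) ³                             ∎
    t-bound : ((U + n) ³ ∸ K) ³ ≤ (3 * n) ³ * (K + ((U + n) ³ ∸ K)) ²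
    t-bound = begin
      ((U + n) ³ ∸ K) ³                     ≤⟨ ³-mono-≤ ([m+n]³∸m³≤3n[m+n]² U n) ⟩
      (3 * n * (U + n) ²) ³                 ≡⟨ regroupU (3 * n) (U + n) ⟩
      (3 * n) ³ * ((U + n) ³) ²             ≡⟨ cong (λ z → (3 * n) ³ * z ²) (m+[n∸m]≡n U³≤[U+n]³) ⟨
      (3 * n) ³ * (K + ((U + n) ³ ∸ K)) ²   ∎
    t≤s : (U + n) ³ ∸ K ≤ Y ∸ K
    t≤s = cube/square-cancel-≤ {γ = (3 * n) ³} (³-mono-< U>0) s-bound t-bound

  -- q ≐ a / D: q equals a/D (mkℚᵘ a d denotes a/(suc d)); no q is a fraction over 0.
  infix 4 _≐_/_
  _≐_/_ : ℚ → ℕ → ℕ → Set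
  q ≐ a / zero  = ⊥
  q ≐ a / suc d = toℚᵘ q ℚᵘ.≃ mkℚᵘ (+ a) d

  toℚᵘ-*-≃ : ∀ {p q p′ q′} → toℚᵘ p ℚᵘ.≃ p′ → toℚᵘ q ℚᵘ.≃ q′ →
             toℚᵘ (p ℚ.* q) ℚᵘ.≃ p′ ℚᵘ.* q′
  toℚᵘ-*-≃ {p} {q} p≃p′ q≃q′ =
    ℚᵘP.≃-trans (ℚP.toℚᵘ-homo-* p q) (ℚᵘP.*-cong p≃p′ q≃q′)

  ≐-* : ∀ {p q a b D E} → p ≐ a / D → q ≐ b / E → p ℚ.* q ≐ a * b / (D * E)
  ≐-* {a = a} {b} {suc _} {suc _} p≐ q≐ =
    ℚᵘP.≃-trans (toℚᵘ-*-≃ p≐ q≐)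
      (ℚᵘP.≃-reflexive (cong (λ z → mkℚᵘ z _) (sym (ℤP.pos-* a b))))

  ≐-cube : ∀ {q a D} → q ≐ a / D → cube q ≐ a ³ / D ³
  ≐-cube q≐ = ≐-* (≐-* q≐ q≐) q≐

  /-≐ : ∀ a D .{{_ : NonZero D}} → + a ℚ./ D ≐ a / D
  /-≐ a (suc d) = ℚP.toℚᵘ-fromℚᵘ (mkℚᵘ (+ a) d)

  ⟦+*+⟧-≐ : ∀ a b → ⟦ + a ℤ.* + b ⟧ ≐ a * b / 1
  ⟦+*+⟧-≐ a b = subst (λ z → ⟦ z ⟧ ≐ a * b / 1) (ℤP.pos-* a b) (/-≐ (a * b) 1)

  0ℚ-≐ : 0ℚ ≐ 0 / 1
  0ℚ-≐ = ℚᵘP.≃-refl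

  ≐-mono-≤ : ∀ {p q a b D E} → p ≐ a / D → q ≐ b / E → p ℚ.≤ q → a * E ≤ b * D
  ≐-mono-≤ {a = a} {b} {suc d} {suc e} p≐ q≐ p≤q =
    ℤP.drop‿+≤+ (subst₂ ℤ._≤_ (sym (ℤP.pos-* a (suc e))) (sym (ℤP.pos-* b (suc d)))
      (ℚᵘP.drop-*≤* (ℚᵘP.≤-respʳ-≃ q≐ (ℚᵘP.≤-respˡ-≃ p≐ (ℚP.toℚᵘ-mono-≤ p≤q)))))

  ≐-cancel-≤ : ∀ {p q a b D E} → p ≐ a / D → q ≐ b / E → a * E ≤ b * D → p ℚ.≤ q
  ≐-cancel-≤ {a = a} {b} {suc d} {suc e} p≐ q≐ aE≤bD =
    ℚP.toℚᵘ-cancel-≤ (ℚᵘP.≤-respˡ-≃ (ℚᵘP.≃-sym p≐) (ℚᵘP.≤-respʳ-≃ (ℚᵘP.≃-sym q≐)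
      (*≤* (subst₂ ℤ._≤_ (ℤP.pos-* a (suc e)) (ℤP.pos-* b (suc d)) (ℤ.+≤+ aE≤bD)))))

  ≐-cancel-< : ∀ {p q a b D E} → p ≐ a / D → q ≐ b / E → a * E < b * D → p ℚ.< q
  ≐-cancel-< {a = a} {b} {suc d} {suc e} p≐ q≐ aE<bD =
    ℚP.toℚᵘ-cancel-< (ℚᵘP.<-respˡ-≃ (ℚᵘP.≃-sym p≐) (ℚᵘP.<-respʳ-≃ (ℚᵘP.≃-sym q≐)
      (*<* (subst₂ ℤ._<_ (ℤP.pos-* a (suc e)) (ℤP.pos-* b (suc d)) (ℤ.+<+ aE<bD)))))

  cube⟦-[1+]⟧<0 : ∀ C → cube ⟦ -[1+ C ] ⟧ ℚ.< 0ℚ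
  cube⟦-[1+]⟧<0 C =
    ℚP.toℚᵘ-cancel-<
      (ℚᵘP.<-respˡ-≃ (ℚᵘP.≃-sym (toℚᵘ-*-≃ (toℚᵘ-*-≃ c≃ c≃) c≃)) (*<* ℤ.-<+))
    where
    c≃ = ℚP.toℚᵘ-fromℚᵘ (mkℚᵘ -[1+ C ] 0)

  nonNeg-outside : (a : PosReal) → ∃[ q ] 0ℚ ℚ.≤ q × ¬ Lower a q
  nonNeg-outside a with bounded a
  ... | q , q∉a with 0ℚ ℚP.≤? q
  ...   | yes q≥0 = q , q≥0 , q∉a
  ...   | no  q≱0 = ⊥-elim (q∉a (downClosed a (ℚP.≰⇒> q≱0) (positive a)))

  Threshold≤-zero : ∀ {a x₀} → 1ℤ ℤ.≤ x₀ → ¬ Threshold≤ a x₀ (+ 0)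
  Threshold≤-zero {a} (ℤ.+≤+ {n = X} 1≤X) th with nonNeg-outside a
  ... | q , q≥0 , q∉a = q∉a (th q q≥0 (ℚP.<-respˡ-≡ (sym (ℚP.*-zeroʳ (cube q)))
          (≐-cancel-< 0ℚ-≐ (⟦+*+⟧-≐ 27 X) (*-monoˡ-< 1 (*-monoʳ-< 27 1≤X)))))

  -- r = 3n/(2k) satisfies r k < 3 ∛X exactly when n³ < 8X.
  Threshold≤⇒Lower : ∀ {a X k n} → Threshold≤ a (+ X) (+ suc k) → n ³ < 8 * X →
                     Lower a (+ (3 * n) ℚ./ (2 * suc k))
  Threshold≤⇒Lower {X = X} {k} {n} th n³<8X =
    th r (≐-cancel-≤ 0ℚ-≐ r≐ z≤n)
       (≐-cancel-< (≐-* (≐-cube r≐) (≐-cube (/-≐ (suc k) 1))) (⟦+*+⟧-≐ 27 X) scaled)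
    where
    open ≤-Reasoning
    r = + (3 * n) ℚ./ (2 * suc k)
    r≐ = /-≐ (3 * n) (2 * suc k)
    scale₁ : ∀ n k → 3 * n * (3 * n) * (3 * n) * (k * k * k) * 1 ≡ 27 * (k * k * k) * (n * n * n)
    scale₁ = solve-∀
    scale₂ : ∀ X k → 27 * X * ((2 * k) * (2 * k) * (2 * k) * 1) ≡ 27 * (k * k * k) * (8 * X)
    scale₂ = solve-∀
    scaled : (3 * n) ³ * suc k ³ * 1 < 27 * X * ((2 * suc k) ³ * 1)
    scaled = begin-strict
      (3 * n) ³ * suc k ³ * 1     ≡⟨ scale₁ n (suc k) ⟩
      27 * suc k ³ * n ³          <⟨ *-monoʳ-< (27 * suc k ³) n³<8X ⟩
      27 * suc k ³ * (8 * X)      ≡⟨ scale₂ X (suc k) ⟨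
      27 * X * ((2 * suc k) ³ * 1) ∎

  MulPow23≤⇒cube≤ : ∀ {a D n X c} .{{_ : NonZero D}} → Lower a (+ (3 * n) ℚ./ D) →
                    MulPow23≤ a (+ X) c → ∃[ C ] c ≡ + C × (3 * n) ³ * X ² ≤ D ³ * C ³
  MulPow23≤⇒cube≤ {D = D} {n} {X} {c} r<a c≥ =
    sample c (c≥ r r<a (≐-cancel-≤ 0ℚ-≐ r≐ z≤n))
    where
    r = + (3 * n) ℚ./ D
    r≐ = /-≐ (3 * n) D
    lhs≐ : cube r ℚ.* ⟦ + X ℤ.* + X ⟧ ≐ (3 * n) ³ * X ² / (D ³ * 1)
    lhs≐ = ≐-* (≐-cube r≐) (⟦+*+⟧-≐ X X)
    sample : ∀ c → cube r ℚ.* ⟦ + X ℤ.* + X ⟧ ℚ.≤ cube ⟦ c ⟧ →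
             ∃[ C ] c ≡ + C × (3 * n) ³ * X ² ≤ D ³ * C ³
    sample (+ C) le = C , refl ,
      subst₂ _≤_ (*-identityʳ _) (trans (cong (C ³ *_) (*-identityʳ (D ³))) (*-comm (C ³) (D ³)))
        (≐-mono-≤ lhs≐ (≐-cube (/-≐ C 1)) le)
    sample -[1+ C ] le = ⊥-elim (ℚP.<-irrefl refl
      (ℚP.≤-<-trans (≐-cancel-≤ 0ℚ-≐ lhs≐ z≤n) (ℚP.≤-<-trans le (cube⟦-[1+]⟧<0 C))))

  +m≡+n-+o⇒n≡m+o : ∀ {m n o} → + m ≡ + n ℤ.- + o → n ≡ m + o
  +m≡+n-+o⇒n≡m+o {m} {n} {o} eq = ℤP.+-injective (begin
    + n                         ≡⟨ ℤP.+-identityʳ (+ n) ⟨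
    + n ℤ.+ 0ℤ                  ≡⟨ cong (ℤ._+_ (+ n)) (ℤP.+-inverseˡ (+ o)) ⟨
    + n ℤ.+ (ℤ.- + o ℤ.+ + o)   ≡⟨ ℤP.+-assoc (+ n) (ℤ.- + o) (+ o) ⟨
    + n ℤ.- + o ℤ.+ + o         ≡⟨ cong (ℤ._+ + o) eq ⟨
    + m ℤ.+ + o                 ≡⟨ ℤP.pos-+ m o ⟨
    + (m + o)                   ∎)
    where open ≡-Reasoning

  1≤⇒≡+ : ∀ {z} → 1ℤ ℤ.≤ z → ∃[ X ] 0 < X × z ≡ + X
  1≤⇒≡+ (ℤ.+≤+ 1≤X) = _ , 1≤X , refl

  infix 4 _/_≤∛_
  _/_≤∛_ : ℕ → ℕ → ℤ → Set
  U / D ≤∛ z = ∃[ m ] z ≡ + m × U ³ ≤ D ³ * m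

  ≤∛-one : ∀ {D z} → 1ℤ ℤ.≤ z → D / D ≤∛ z
  ≤∛-one {D} (ℤ.+≤+ 1≤X) =
    _ , refl , ≤-trans (≤-reflexive (sym (*-identityʳ (D ³)))) (*-monoʳ-≤ (D ³) 1≤X)

  ≤∛0-impossible : ∀ {U D} → 0 < U → ¬ (U / D ≤∛ 0ℤ)
  ≤∛0-impossible {U} {D} U>0 (.0 , refl , U³≤D³*0) =
    <⇒≱ (³-mono-< U>0) (≤-trans U³≤D³*0 (≤-reflexive (*-zeroʳ (D ³))))

  cubeRoot<1+n/2 : ∀ {k n X} → 0 < k → 8 * X ≤ suc n ³ → ¬ (2 * k + k * n / 2 * k ≤∛ + X)
  cubeRoot<1+n/2 {k} {n} {X} k>0 8X≤[1+n]³ (.X , refl , [2k+kn]³≤[2k]³X) =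
    <⇒≱ [2k]³X<[2k+kn]³ [2k+kn]³≤[2k]³X
    where
    open ≤-Reasoning
    scale₁ : ∀ k X → (2 * k) * (2 * k) * (2 * k) * X ≡ k * k * k * (8 * X)
    scale₁ = solve-∀
    scale₂ : ∀ k n → k * k * k * ((2 + n) * (2 + n) * (2 + n))
                   ≡ (2 * k + k * n) * (2 * k + k * n) * (2 * k + k * n)
    scale₂ = solve-∀
    [2k]³X<[2k+kn]³ : (2 * k) ³ * X < (2 * k + k * n) ³
    [2k]³X<[2k+kn]³ = begin-strict
      (2 * k) ³ * X          ≡⟨ scale₁ k X ⟩
      k ³ * (8 * X)          ≤⟨ *-monoʳ-≤ (k ³) 8X≤[1+n]³ ⟩
      k ³ * suc n ³          <⟨ *-monoʳ-< (k ³) {{>-nonZero (³-mono-< k>0)}}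
                                  (³-mono-< (n<1+n (suc n))) ⟩
      k ³ * (2 + n) ³        ≡⟨ scale₂ k n ⟩
      (2 * k + k * n) ³      ∎

  ≤∛-step : ∀ {a D n U x x′} .{{_ : NonZero D}} → Lower a (+ (3 * n) ℚ./ D) →
            Step a x x′ → 0 < U → U / D ≤∛ x′ → U + n / D ≤∛ x
  ≤∛-step {a} {D} {n} {U} {x} r<a (descend , stop) U>0 x′≥ with 1ℤ ℤ.≤? x
  ... | no 1≰x =
    ⊥-elim (≤∛0-impossible {U} {D} U>0 (subst (λ z → U / D ≤∛ z) (stop (ℤP.≰⇒> 1≰x)) x′≥))
  ... | yes 1≤x@(ℤ.+≤+ {n = X} _) with descend 1≤x | x′≥
  ...   | c , (c≥ , _) , x′≡x-c | m , refl , U³≤D³m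
    with MulPow23≤⇒cube≤ {a} {D} {n} {X} {c} r<a c≥
  ...     | C , refl , bound with +m≡+n-+o⇒n≡m+o {n = X} {o = C} x′≡x-c
  ...       | refl = m + C , refl , cubeRoot-increment {D} {n} U>0 U³≤D³m bound

  ≤∛-iterate : ∀ {a D n} {x : ℕ → ℤ} .{{_ : NonZero D}} → Lower a (+ (3 * n) ℚ./ D) →
               (∀ j → Step a (x j) (x (suc j))) →
               ∀ i {U} → 0 < U → U / D ≤∛ x i → U + i * n / D ≤∛ x 0
  ≤∛-iterate {D = D} {x = x} _ _ zero {U} _ U≤ =
    subst (λ V → V / D ≤∛ x 0) (sym (+-identityʳ U)) U≤
  ≤∛-iterate {a} {D} {n} {x} r<a steps (suc i) {U} U>0 U≤ =
    subst (λ V → V / D ≤∛ x 0) (+-assoc U n (i * n))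
      (≤∛-iterate {a} {D} {n} {x} r<a steps i (<-≤-trans U>0 (m≤m+n U n))
        (≤∛-step {a} {D} {n} r<a (steps i) U>0 U≤))

open import Data.Nat using (ℕ; suc; zero; z<s; _+_; _*_)
open import Data.Integer using (ℤ; +_; _≤_; 1ℤ)
open import Data.Nat.Properties using (*-monoʳ-<)
open import Data.Integer.Properties using (<⇒≤; ≰⇒>)
open import Data.Empty using (⊥-elim)
open import Data.Product using (_,_)
open import Data.Rational using (_/_)
open import Relation.Binary.PropositionalEquality using (subst)
open import Relation.Nullary using (¬_)
open CubeRootDescent

lemmaA10 : (a : PosReal) (x : ℕ → ℤ) →
           1ℤ ≤ x 0 →
           (∀ k → Step a (x k) (x (suc k))) →
           ∀ (k : ℕ) → Threshold≤ a (x 0) (+ k) → x k ≤ 1ℤ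
lemmaA10 a x 1≤x₀ steps zero th = ⊥-elim (Threshold≤-zero {a} 1≤x₀ th)
lemmaA10 a x 1≤x₀ steps k@(suc k′) th with 1≤⇒≡+ 1≤x₀
... | X₀ , X₀>0 , x₀≡X₀ with ∃-cube-bracket (8 * X₀) (*-monoʳ-< 8 X₀>0)
... | n , n³<8X₀ , 8X₀≤[1+n]³ = <⇒≤ (≰⇒> 1≰xₖ)
  where
  r<a : Lower a (+ (3 * n) / (2 * k))
  r<a = Threshold≤⇒Lower {a} {X₀} {k′} {n}
          (subst (λ x₀ → Threshold≤ a x₀ (+ k)) x₀≡X₀ th) n³<8X₀
  1≰xₖ : ¬ (1ℤ ≤ x k)
  1≰xₖ 1≤xₖ = cubeRoot<1+n/2 {k} {n} {X₀} z<s 8X₀≤[1+n]³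
    (subst (λ x₀ → 2 * k + k * n / 2 * k ≤∛ x₀) x₀≡X₀
      (≤∛-iterate {a} {2 * k} {n} {x} r<a steps k {2 * k} z<s (≤∛-one {2 * k} 1≤xₖ)))
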